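{- If $\mathcal{L}$ is a better elastic set system, then both $\mathcal{L}^{<\omega}:=\{\bigcup\mathcal{M}:\emptyset\ne\mathcal{M}\subseteq\mathcal{L},\ \mathcal{M}\text{ finite}\}$ and $\hat{\mathcal{L}}:=\{\bigcup\mathcal{M}:\emptyset\ne\mathcal{M}\subseteq\mathcal{L}\}$ are finitely elastic set systems.
   Context: A set system over $T$ is a family $\subseteq P(T)$; $\mathrm{qo}(\mathcal{L})$ is the quasi-ordering on $\bigcup\mathcal{L}$ with $x\preceq y$ iff every member of $\mathcal{L}$ containing $x$ contains $y$. $\mathcal{L}$ is a better elastic set system if $\mathrm{qo}(\mathcal{L})$ is a better quasi-ordering (BQO): a barrier is a family $B$ of finite subsets of $\omega$ (identified with increasing sequences) with $\bigcup B$ infinite, every infinite $\sigma\subseteq\bigcup B$ having a member of $B$ as a prefix of its increasing enumeration, and no member a proper subset of another; $s\triangleleft t$ means $s$ is a prefix of $u=s\cup t$ and $t$ is a prefix of $u\setminus\{\min u\}$; $(Q,\preceq)$ is a BQO if for every barrier $B$ and every $f:B\to Q$ there exist $s\triangleleft t$ in $B$ with $f(s)\preceq f(t)$. A learning sequence of $\mathcal{L}$ is $\langle\langle t_0,A_1\rangle,\langle t_1,A_2\rangle,\ldots\rangle$ with $A_{i+1}\in\mathcal{L}$ and $\{t_0,\ldots,t_i\}\subseteq A_{i+1}$; it is bad if $t_{i+1}\notin A_{i+1}$ for all $i$; $\mathcal{L}$ is a finitely elastic set system if it has no infinite bad learning sequence. -}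

module Defs where

open import Level using (Level; _⊔_) renaming (suc to lsuc; zero to lzero)
open import Data.Nat using (ℕ; suc; _≤_; _<_)
open import Data.List using (List; []; _∷_; take; drop; applyUpTo)
open import Data.List.Membership.Propositional using (_∈_)
open import Data.List.Relation.Binary.Subset.Propositional using (_⊆_)
open import Data.List.Relation.Unary.All using (All)
open import Data.List.Relation.Unary.Any using (Any)
open import Data.List.Relation.Unary.Linked using (Linked)
open import Data.Product using (Σ; ∃; ∃-syntax; _×_; _,_)
open import Data.Sum using (_⊎_)
open import Relation.Nullary using (¬_)
open import Relation.Binary.PropositionalEquality using (_≡_; _≢_)
open import Function.Bundles using (_⇔_)

-- Finite subsets of ω as strictly increasing lists; barriers; BQO

Increasing : List ℕ → Set
Increasing = Linked _<_

Prefix : List ℕ → List ℕ → Set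
Prefix s u = ∃[ k ] take k u ≡ s

_◁_ : List ℕ → List ℕ → Set
s ◁ t = ∃[ u ] Increasing u
              × (∀ x → x ∈ u ⇔ (x ∈ s ⊎ x ∈ t))
              × Prefix s u
              × Prefix t (drop 1 u)

Family : Set₁
Family = List ℕ → Set

record IsBarrier (B : Family) : Set where
  field
    increasing : ∀ s → B s → Increasing s
    union-infinite : ∀ n → ∃[ m ] n ≤ m × (∃[ s ] B s × m ∈ s)
    -- every infinite σ ⊆ ⋃ B (given by its strictly increasing
    -- enumeration σ) has a member of B as a prefix of its enumeration
    prefix-property : (σ : ℕ → ℕ) → (∀ n → σ n < σ (suc n))
                    → (∀ n → ∃[ s ] B s × σ n ∈ s)
                    → ∃[ k ] B (applyUpTo σ k)
    antichain : ∀ s t → B s → B t → ¬ (s ⊆ t × ¬ (t ⊆ s))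

IsBQO : ∀ {a b} (Q : Set a) → (Q → Q → Set b) → Set (lsuc lzero ⊔ a ⊔ b)
IsBQO Q _≼_ = (B : Family) → IsBarrier B → (f : (s : List ℕ) → B s → Q)
            → ∃[ s ] ∃[ t ] Σ (B s) λ bs → Σ (B t) λ bt →
                 (s ◁ t) × f s bs ≼ f t bt

Subset : Set → Set₁
Subset T = T → Set

SetSystem : ∀ ℓ → Set → Set (lsuc lzero ⊔ lsuc ℓ)
SetSystem ℓ T = Subset T → Set ℓ

module _ {ℓ} {T : Set} (L : SetSystem ℓ T) where

  UnionCarrier : Set (lsuc lzero ⊔ ℓ)
  UnionCarrier = Σ T λ x → ∃[ A ] L A × A x

  _≼qo_ : UnionCarrier → UnionCarrier → Set (lsuc lzero ⊔ ℓ)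
  (x , _) ≼qo (y , _) = ∀ A → L A → A x → A y

  BetterElastic : Set (lsuc lzero ⊔ ℓ)
  BetterElastic = IsBQO UnionCarrier _≼qo_

  -- an infinite learning sequence ⟨⟨t₀,A₁⟩,⟨t₁,A₂⟩,…⟩ is given by
  -- t : ℕ → T and A : ℕ → Subset T with  A i  standing for A_{i+1}
  IsLearningSequence : (ℕ → T) → (ℕ → Subset T) → Set ℓ
  IsLearningSequence t A = ∀ i → L (A i) × (∀ j → j ≤ i → A i (t j))

  IsBad : (ℕ → T) → (ℕ → Subset T) → Set
  IsBad t A = ∀ i → ¬ A i (t (suc i))

  FinitelyElastic : Set (lsuc lzero ⊔ ℓ)
  FinitelyElastic = ¬ (∃[ t ] ∃[ A ] IsLearningSequence t A × IsBad t A)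

  FinUnions : SetSystem (lsuc lzero ⊔ ℓ) T
  FinUnions X = ∃[ Ms ] Ms ≢ [] × All L Ms
                  × (∀ x → X x ⇔ Any (λ A → A x) Ms)

  -- L̂ = { ⋃ M : ∅ ≠ M ⊆ L }
  -- (M ranges over subfamilies given as predicates of the same level as L)
  AllUnions : SetSystem (lsuc lzero ⊔ lsuc ℓ) T
  AllUnions X = Σ (SetSystem ℓ T) λ M → (∃[ A ] M A) × (∀ A → M A → L A)
                  × (∀ x → X x ⇔ (∃[ A ] M A × A x))

-- Applied to the singleton barrier, the BQO property of qo(L) says that every
-- sequence of points of ⋃ L has indices m < n with x_m ≼ x_n. In a bad learning
-- sequence for a system of unions of members of L, write n = p + 1: the point
-- t_m lies in some C ∈ L with C ⊆ A_p, and t_m ≼ t_n puts t_n in C ⊆ A_p,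
-- contradicting badness.
module Submission where

open import Defs
open import Level using (Level; _⊔_) renaming (suc to lsuc; zero to lzero)
open import Data.Product using (_×_; ∃-syntax; _,_; proj₁; proj₂)
open import Data.Nat using (ℕ; zero; suc; _≤_; _<_; s≤s)
open import Data.Nat.Properties using (≤-refl)
open import Data.List using ([]; _∷_)
open import Data.List.Properties using (∷-injectiveˡ)
open import Data.List.Relation.Unary.Any using (here; there)
open import Data.List.Relation.Unary.All as All using ()
open import Data.List.Relation.Unary.Linked using ([-]; _∷_)
open import Data.List.Relation.Binary.Subset.Propositional using (_⊆_)
open import Data.List.Membership.Propositional using (find; lose)
open import Relation.Binary.PropositionalEquality using (_≡_; refl; sym; trans)
open import Relation.Nullary using (¬_)
open import Function.Bundles using (Equivalence)
open Equivalence using (to; from)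

Singletons : Family
Singletons s = ∃[ n ] s ≡ n ∷ []

singletons-antichain : ∀ s t → Singletons s → Singletons t → ¬ (s ⊆ t × ¬ (t ⊆ s))
singletons-antichain _ _ (m , refl) (n , refl) (s⊆t , t⊈s) with s⊆t (here refl)
... | here m≡n = t⊈s λ { (here x≡n) → here (trans x≡n (sym m≡n)) ; (there ()) }
... | there ()

singletons-isBarrier : IsBarrier Singletons
singletons-isBarrier = record
  { increasing      = λ { _ (n , refl) → [-] }
  ; union-infinite  = λ n → n , ≤-refl , (n ∷ []) , (n , refl) , here refl
  ; prefix-property = λ σ _ _ → 1 , (σ 0 , refl)
  ; antichain       = singletons-antichain
  }

-- The witness u must be m ∷ n ∷ _, and it is increasing.
◁-singleton⇒< : ∀ {m n} → (m ∷ []) ◁ (n ∷ []) → m < n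
◁-singleton⇒< ([]        , _       , _ , (zero  , ()) , _)
◁-singleton⇒< ([]        , _       , _ , (suc _ , ()) , _)
◁-singleton⇒< (_ ∷ _     , _       , _ , (zero  , ()) , _)
◁-singleton⇒< (_ ∷ []    , _       , _ , (suc _ , _)  , (zero  , ()))
◁-singleton⇒< (_ ∷ []    , _       , _ , (suc _ , _)  , (suc _ , ()))
◁-singleton⇒< (_ ∷ _ ∷ _ , _       , _ , (suc _ , _)  , (zero  , ()))
◁-singleton⇒< (_ ∷ _ ∷ _ , a<b ∷ _ , _ , (suc _ , u≡m) , (suc _ , u′≡n))
  rewrite ∷-injectiveˡ u≡m | ∷-injectiveˡ u′≡n = a<b

IsBQO⇒good : ∀ {a b} {Q : Set a} {_≼_ : Q → Q → Set b} → IsBQO Q _≼_ →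
             (f : ℕ → Q) → ∃[ m ] ∃[ n ] m < n × f m ≼ f n
IsBQO⇒good bqo f with bqo Singletons singletons-isBarrier (λ { _ (n , _) → f n })
... | _ , _ , (m , refl) , (n , refl) , m◁n , fm≼fn = m , n , ◁-singleton⇒< m◁n , fm≼fn

module _ {ℓ} {T : Set} (L : SetSystem ℓ T) where

  IsUnionOf : Subset T → Set (lsuc lzero ⊔ ℓ)
  IsUnionOf X = ∀ {x} → X x → ∃[ C ] L C × C x × (∀ {y} → C y → X y)

  finitelyElastic-if-unionsOf : ∀ {ℓ′} (L′ : SetSystem ℓ′ T) →
    (∀ {X} → L′ X → IsUnionOf X) → BetterElastic L → FinitelyElastic L′
  finitelyElastic-if-unionsOf L′ unionOf bqo (t , A , learning , bad) =
    refute (IsBQO⇒good {_≼_ = _≼qo_ L} bqo point)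
    where
    covering : ∀ {m} p → m ≤ p → ∃[ C ] L C × C (t m) × (∀ {y} → C y → A p y)
    covering p m≤p = unionOf (proj₁ (learning p)) (proj₂ (learning p) _ m≤p)

    point : ℕ → UnionCarrier L
    point n with covering n ≤-refl
    ... | C , LC , Ct , _ = t n , C , LC , Ct

    refute : ¬ (∃[ m ] ∃[ n ] m < n × _≼qo_ L (point m) (point n))
    refute (_ , zero  , () , _)
    refute (m , suc p , s≤s m≤p , tm≼tn) with covering p m≤p
    ... | C , LC , Ctm , C⊆Ap = bad p (C⊆Ap (tm≼tn C LC Ctm))

  finUnions-isUnionOf : ∀ {X} → FinUnions L X → IsUnionOf X
  finUnions-isUnionOf (Ms , _ , LMs , X⇔⋃Ms) Xx with find (to (X⇔⋃Ms _) Xx)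
  ... | C , C∈Ms , Cx = C , All.lookup LMs C∈Ms , Cx , λ Cy → from (X⇔⋃Ms _) (lose C∈Ms Cy)

  allUnions-isUnionOf : ∀ {X} → AllUnions L X → IsUnionOf X
  allUnions-isUnionOf (M , _ , M⊆L , X⇔⋃M) Xx with to (X⇔⋃M _) Xx
  ... | C , MC , Cx = C , M⊆L C MC , Cx , λ Cy → from (X⇔⋃M _) (C , MC , Cy)

corollary3 : ∀ {ℓ : Level} {T : Set} (L : SetSystem ℓ T)
           → BetterElastic L
           → FinitelyElastic (FinUnions L) × FinitelyElastic (AllUnions L)
corollary3 L bqo = finitelyElastic-if-unionsOf L (FinUnions L) (finUnions-isUnionOf L) bqo
                 , finitelyElastic-if-unionsOf L (AllUnions L) (allUnions-isUnionOf L) bqo
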